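{- Let $\mathcal{G}=(V_\mathcal{G},E^+_\mathcal{G},E^-_\mathcal{G},L_\mathcal{G})$ be a signed graph with $V_\mathcal{G}=[n]$. If every edge ordering of $\mathcal{G}$ is an even (respectively, odd) full cyclic permutation ordering, then $\bar{\mathcal{G}}$ is a tree.
   Context: $[n]=\{1,\dots,n\}$, $I_n=\{ -n,\dots,-1,1,\dots,n\}$, $\mathfrak{H}_n=\{\eta\in\mathfrak{S}_{I_n}:\eta(-i)=-\eta(i)\ \forall i\in I_n\}$. For distinct $i,j\in[n]$: $(i\ j)$ swaps $i\leftrightarrow j$, $-i\leftrightarrow -j$; $(i\ { -j})$ sends $i\mapsto -j$, $j\mapsto -i$ (and correspondingly on negatives); for $i\in[n]$, $(i\ { -i})$ swaps $i\leftrightarrow -i$; each fixes everything else. $\eta\in\mathfrak{H}_n$ is an even (resp. odd) full cyclic permutation if there are an ordering $i_1,\dots,i_n$ of $[n]$ and signs $\epsilon_k\in\{\pm1\}$ with $\eta(i_k)=\epsilon_k i_{k+1}$ (indices mod $n$) and $\epsilon_1\cdots\epsilon_n=+1$ (resp. $-1$). A signed graph is $\mathcal{G}=(V_\mathcal{G},E^+_\mathcal{G},E^-_\mathcal{G},L_\mathcal{G})$ with $V_\mathcal{G}=[n]$, $E^\pm_\mathcal{G}$ sets of 2-element subsets of $[n]$, $L_\mathcal{G}\subseteq[n]$ (loops); $E_\mathcal{G}=E^+_\mathcal{G}\sqcup E^-_\mathcal{G}\sqcup L_\mathcal{G}$. Set $\tau_e=(i\ j)$, $(i\ { -j})$, $(i\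 { -i})$ for $e=\{i,j\}\in E^+_\mathcal{G}$, $e=\{i,j\}\in E^-_\mathcal{G}$, $e=i\in L_\mathcal{G}$ respectively. For an edge ordering (linear order) $\omega=(e_1,\dots,e_m)$ of $E_\mathcal{G}$, $\pi_\omega=\tau_{e_m}\cdots\tau_{e_1}$; $\omega$ is an even (resp. odd) full cyclic permutation ordering if $\pi_\omega$ is an even (resp. odd) full cyclic permutation. $\bar{\mathcal{G}}$ is the unsigned multigraph on $[n]$ with edge multiset $E^+_\mathcal{G}\sqcup E^-_\mathcal{G}$ (a pair in both $E^+_\mathcal{G}$ and $E^-_\mathcal{G}$ gives two parallel edges). -}

module Defs where

open import Data.Nat using (ℕ; zero; suc; _<_)
open import Data.Fin using (Fin; zero; suc; toℕ; _≟_)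
open import Data.Fin.Permutation using (Permutation′; _⟨$⟩ʳ_)
open import Data.Sign using (Sign; +; -) renaming (_*_ to _·_)
open import Data.Product using (Σ; _×_; _,_; proj₁; proj₂)
open import Data.Sum using (_⊎_)
open import Data.List using (List; []; _∷_; map; _++_; length; lookup; foldl)
open import Data.List.Relation.Unary.All using (All)
open import Data.List.Relation.Unary.Unique.Propositional using (Unique)
open import Data.List.Relation.Binary.Permutation.Propositional using (_↭_)
open import Data.List.Membership.Propositional using (_∈_)
open import Relation.Binary.Construct.Closure.ReflexiveTransitive using (Star)
open import Relation.Binary.PropositionalEquality using (_≡_)
open import Relation.Nullary using (¬_; yes; no)
open import Function.Definitions using (Injective)

-- An element of I_n is encoded as (s , i) : Sign × Fin n,
-- standing for s·i.  An element η of 𝔥_n is determined by its values on [n]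
-- (η(-i) = -η(i)), so we encode it as a map Fin n → Sign × Fin n.

SignedPerm : ℕ → Set
SignedPerm n = Fin n → Sign × Fin n

idSP : ∀ {n} → SignedPerm n
idSP i = (+ , i)

-- (g ∘ f) : first apply f, then g  (extending g to negatives by g(-i) = -g(i))
_∘SP_ : ∀ {n} → SignedPerm n → SignedPerm n → SignedPerm n
(g ∘SP f) i = (proj₁ (f i) · proj₁ (g (proj₂ (f i))) , proj₂ (g (proj₂ (f i))))

sucMod : ∀ {n} → Fin n → Fin n
sucMod {suc zero} zero = zero
sucMod {suc (suc n)} zero = suc zero
sucMod {suc (suc n)} (suc i) with sucMod {suc n} i
... | zero = zero
... | suc j = suc (suc j)

prodSign : ∀ {n} → (Fin n → Sign) → Sign
prodSign {zero} ε = +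
prodSign {suc n} ε = ε zero · prodSign (λ k → ε (suc k))

-- η is a full cyclic permutation of parity s (s = + : even, s = - : odd):
-- an ordering i_0,…,i_{n-1} of [n] (given by the bijection σ, i_k = σ k) and
-- signs ε_k with η(i_k) = ε_k i_{k+1} (indices mod n) and ε_0⋯ε_{n-1} = s.
FullCyclic : ∀ {n} → Sign → SignedPerm n → Set
FullCyclic {n} s η =
  Σ (Permutation′ n) λ σ → Σ (Fin n → Sign) λ ε →
    (∀ k → η (σ ⟨$⟩ʳ k) ≡ (ε k , σ ⟨$⟩ʳ sucMod k)) × (prodSign ε ≡ s)

-- Signed graphs on [n].  A 2-element subset {i,j} is encoded by the pair
-- (i , j) with i < j; sets are duplicate-free lists.

record SignedGraph (n : ℕ) : Set where
  field
    E⁺ : List (Fin n × Fin n)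
    E⁻ : List (Fin n × Fin n)
    L  : List (Fin n)
    E⁺-ordered : All (λ p → toℕ (proj₁ p) < toℕ (proj₂ p)) E⁺
    E⁻-ordered : All (λ p → toℕ (proj₁ p) < toℕ (proj₂ p)) E⁻
    E⁺-unique : Unique E⁺
    E⁻-unique : Unique E⁻
    L-unique  : Unique L
open SignedGraph public

data Edge (n : ℕ) : Set where
  posE : Fin n → Fin n → Edge n
  negE : Fin n → Fin n → Edge n
  loopE : Fin n → Edge n

edges : ∀ {n} → SignedGraph n → List (Edge n)
edges G = map (λ p → posE (proj₁ p) (proj₂ p)) (E⁺ G)
       ++ map (λ p → negE (proj₁ p) (proj₂ p)) (E⁻ G)
       ++ map loopE (L G)

EdgeOrdering : ∀ {n} → SignedGraph n → List (Edge n) → Set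
EdgeOrdering G ω = ω ↭ edges G

τ : ∀ {n} → Edge n → SignedPerm n
τ (posE i j) k with k ≟ i | k ≟ j
... | yes _ | _ = (+ , j)
... | no _ | yes _ = (+ , i)
... | no _ | no _ = (+ , k)
τ (negE i j) k with k ≟ i | k ≟ j
... | yes _ | _ = (- , j)
... | no _ | yes _ = (- , i)
... | no _ | no _ = (+ , k)
τ (loopE i) k with k ≟ i
... | yes _ = (- , i)
... | no _ = (+ , k)

-- π_ω = τ_{e_m} ⋯ τ_{e_1}  (τ_{e_1} applied first)
πω : ∀ {n} → List (Edge n) → SignedPerm n
πω = foldl (λ π e → τ e ∘SP π) idSP

-- Unsigned multigraphs on [n], given by a list of edges (parallel edges are
-- repeated entries); edge number t joins the two endpoints of lookup es t.

barG : ∀ {n} → SignedGraph n → List (Fin n × Fin n)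
barG G = E⁺ G ++ E⁻ G

Joins : ∀ {n} → Fin n × Fin n → Fin n → Fin n → Set
Joins (a , b) u v = (a ≡ u × b ≡ v) ⊎ (a ≡ v × b ≡ u)

Adjacent : ∀ {n} → List (Fin n × Fin n) → Fin n → Fin n → Set
Adjacent es u v = Σ _ λ e → (e ∈ es) × Joins e u v

Connected : ∀ {n} → List (Fin n × Fin n) → Set
Connected es = ∀ u v → Star (Adjacent es) u v

record Cycle {n : ℕ} (es : List (Fin n × Fin n)) : Set where
  field
    k : ℕ
    vs : Fin (suc k) → Fin n
    ix : Fin (suc k) → Fin (length es)
    vs-inj : Injective _≡_ _≡_ vs
    ix-inj : Injective _≡_ _≡_ ix
    joins : ∀ t → Joins (lookup es (ix t)) (vs t) (vs (sucMod t))

Acyclic : ∀ {n} → List (Fin n × Fin n) → Set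
Acyclic es = ¬ Cycle es

IsTree : ∀ {n} → List (Fin n × Fin n) → Set
IsTree es = Connected es × Acyclic es

module Submission where

-- Forgetting signs, π_ω acts on [n] as the composite of the transpositions
-- underlying the edges, and a full cyclic permutation of [n] with n ≥ 2 moves
-- every element.
--
-- Connected: for the given edge list, π_ω sends i_k to ±i_(k+1); following the
-- position of i_k through the successive transpositions is a walk in Ḡ from
-- i_k to i_(k+1), and the i_k exhaust [n].
--
-- Acyclic: given a cycle v_0 v_1 ⋯ v_k v_0 of Ḡ, order the edges so that the
-- image of v_0 is carried once around the cycle by the cycle edges, while every
-- other edge is applied when that image is not one of its endpoints: first the
-- edges avoiding v_0, then v_0v_1, then the remaining edges avoiding v_1, then
-- v_1v_2, then the remaining edges (parallel to v_0v_1, so they avoid v_2; for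
-- k = 1 there are none, since Ḡ has at most two edges between two vertices), and
-- finally the rest of the cycle. This π_ω fixes v_0 up to sign, so it is not
-- full cyclic.

open import Defs
open import Data.Nat using (ℕ; zero; suc; _+_; _<_; _≤_; z≤n; s≤s; pred) renaming (_≟_ to _≟ℕ_)
open import Data.Nat.Properties
  using (≤-refl; ≤-antisym; <⇒≤; m≤n⇒m≤1+n; ≤-<-connex; 1+n≢n; 0≢1+n; <-irrefl; <-asym; +-monoʳ-<)
open import Data.Nat.GeneralisedArithmetic using (fold)
open import Data.Fin using (Fin; zero; suc; toℕ; _≟_; fromℕ<)
open import Data.Fin.Properties using (toℕ-injective; toℕ≤pred[n]; toℕ<n; toℕ-fromℕ<; any?)
open import Data.Fin.Permutation using (_⟨$⟩ʳ_; _⟨$⟩ˡ_; inverseʳ)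
open import Data.Fin.Permutation.Components using (transpose)
open import Data.Product using (Σ; ∃; _×_; _,_; proj₁; proj₂)
open import Data.Sum as Sum using (_⊎_; inj₁; inj₂; [_,_])
open import Data.Empty using (⊥; ⊥-elim)
open import Data.Sign using (Sign)
open import Data.List
  using (List; []; _∷_; _++_; _∷ʳ_; length; lookup; map; filter; foldl; concatMap; upTo)
open import Data.List.Properties
  using (filter-accept; filter-reject; filter-none; foldl-++; concatMap-++; upTo-∷ʳ; ++-identityʳ)
open import Data.List.Membership.Propositional using (_∈_)
open import Data.List.Membership.Propositional.Properties
  using (∈-lookup; ∈-map⁺; ∈-map⁻; ∈-++⁺ˡ; ∈-++⁺ʳ; ∈-++⁻; ∈-filter⁺; ∈-filter⁻; ∈-concat⁺′; ∈-concat⁻′; ∈-upTo⁺)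
open import Data.List.Membership.Propositional.Properties.WithK using (unique∧set⇒bag)
open import Data.List.Relation.Unary.Any using (here; there)
import Data.List.Relation.Unary.All as All
import Data.List.Relation.Unary.All.Properties as All
import Data.List.Relation.Unary.AllPairs as AllPairs
import Data.List.Relation.Unary.AllPairs.Properties as AllPairs
open import Data.List.Relation.Unary.Unique.Propositional using (Unique; []; _∷_)
import Data.List.Relation.Unary.Unique.Propositional.Properties as Unique
open import Data.List.Relation.Binary.Permutation.Propositional using (_↭_; ↭-refl)
open import Data.List.Relation.Binary.BagAndSetEquality using (∼bag⇒↭)
open import Function using (id; _∘_)
open import Function.Bundles using (Injection; mk⇔)
open import Function.Definitions using (Injective)
open import Function.Properties.Inverse using (↔⇒↣)
open import Relation.Nullary using (¬_; Dec; yes; no; map′)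
open import Relation.Nullary.Decidable using (_⊎-dec_; _×-dec_)
open import Relation.Unary using (Pred; Decidable)
open import Relation.Binary.Definitions using (DecidableEquality)
open import Relation.Binary.Construct.Closure.ReflexiveTransitive using (Star; ε; _◅_; _◅◅_; reverse)
open import Relation.Binary.PropositionalEquality hiding ([_])

move : ∀ {n} → Edge n → Fin n → Fin n
move e p = proj₂ (τ e p)

walk : ∀ {n} → List (Edge n) → Fin n → Fin n
walk ω p = foldl (λ q e → move e q) p ω

proj₂-πω : ∀ {n} (ω : List (Edge n)) i → proj₂ (πω ω i) ≡ walk ω i
proj₂-πω = go idSP
  where
  go : ∀ {n} (π : SignedPerm n) (ω : List (Edge n)) i →
       proj₂ (foldl (λ π e → τ e ∘SP π) π ω i) ≡ walk ω (proj₂ (π i))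
  go π []      i = refl
  go π (e ∷ ω) i = go (τ e ∘SP π) ω i

data Link {n} : Edge n → Fin n × Fin n → Set where
  pos : ∀ {a b} → Link (posE a b) (a , b)
  neg : ∀ {a b} → Link (negE a b) (a , b)

move-link : ∀ {n} {e : Edge n} {a b} → Link e (a , b) → ∀ p → move e p ≡ transpose a b p
move-link {a = a} {b} pos p with p ≟ a
... | yes _ = refl
... | no _ with p ≟ b
...   | yes _ = refl
...   | no _  = refl
move-link {a = a} {b} neg p with p ≟ a
... | yes _ = refl
... | no _ with p ≟ b
...   | yes _ = refl
...   | no _  = refl

move-loop : ∀ {n} (i p : Fin n) → move (loopE i) p ≡ p
move-loop i p with p ≟ i
... | yes p≡i = sym p≡i
... | no _    = refl

transpose-fixes : ∀ {n} {a b p : Fin n} → p ≢ a → p ≢ b → transpose a b p ≡ p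
transpose-fixes {a = a} {b} {p} p≢a p≢b with p ≟ a
... | yes p≡a = ⊥-elim (p≢a p≡a)
... | no _ with p ≟ b
...   | yes p≡b = ⊥-elim (p≢b p≡b)
...   | no _    = refl

transpose-joins : ∀ {n} {a b u v : Fin n} → Joins (a , b) u v → u ≢ v → transpose a b u ≡ v
transpose-joins {a = a} {b} {u} j u≢v with u ≟ a
transpose-joins (inj₁ (refl , refl)) u≢v | yes _ = refl
transpose-joins (inj₂ (refl , refl)) u≢v | yes refl = ⊥-elim (u≢v refl)
... | no u≢a with u ≟ b
transpose-joins (inj₁ (refl , refl)) u≢v | no u≢a | _ = ⊥-elim (u≢a refl)
transpose-joins (inj₂ (refl , refl)) u≢v | no u≢a | yes _ = refl
transpose-joins (inj₂ (refl , refl)) u≢v | no u≢a | no u≢b = ⊥-elim (u≢b refl)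

transpose-stays-or-crosses : ∀ {n} (a b p : Fin n) →
  transpose a b p ≡ p ⊎ Joins (a , b) p (transpose a b p)
transpose-stays-or-crosses a b p with p ≟ a
... | yes refl = inj₂ (inj₁ (refl , refl))
... | no _ with p ≟ b
...   | yes refl = inj₂ (inj₂ (refl , refl))
...   | no _     = inj₁ refl

-- A loop only flips a sign, so it moves no vertex.
Touches : ∀ {n} → Edge n → Fin n → Set
Touches (posE a b) p = p ≡ a ⊎ p ≡ b
Touches (negE a b) p = p ≡ a ⊎ p ≡ b
Touches (loopE _)  p = ⊥

touches? : ∀ {n} (e : Edge n) p → Dec (Touches e p)
touches? (posE a b) p = p ≟ a ⊎-dec p ≟ b
touches? (negE a b) p = p ≟ a ⊎-dec p ≟ b
touches? (loopE _)  p = no λ ()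

touches-link : ∀ {n} {e : Edge n} {a b p} → Link e (a , b) → Touches e p → p ≡ a ⊎ p ≡ b
touches-link pos t = t
touches-link neg t = t

touches-link⁻ : ∀ {n} {e : Edge n} {p} → Touches e p → ∃ (Link e)
touches-link⁻ {e = posE a b} _ = (a , b) , pos
touches-link⁻ {e = negE a b} _ = (a , b) , neg

move-untouched : ∀ {n} (e : Edge n) {p} → ¬ Touches e p → move e p ≡ p
move-untouched (posE a b) {p} ¬t = trans (move-link pos p) (transpose-fixes (¬t ∘ inj₁) (¬t ∘ inj₂))
move-untouched (negE a b) {p} ¬t = trans (move-link neg p) (transpose-fixes (¬t ∘ inj₁) (¬t ∘ inj₂))
move-untouched (loopE i)  {p} ¬t = move-loop i p

touching-both-joins : ∀ {n} {e : Edge n} {a b x y} → Link e (a , b) →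
  Touches e x → Touches e y → x ≢ y → Joins (a , b) x y
touching-both-joins l tx ty x≢y with touches-link l tx | touches-link l ty
... | inj₁ refl | inj₁ refl = ⊥-elim (x≢y refl)
... | inj₁ refl | inj₂ refl = inj₁ (refl , refl)
... | inj₂ refl | inj₁ refl = inj₂ (refl , refl)
... | inj₂ refl | inj₂ refl = ⊥-elim (x≢y refl)

Joins-endpoint : ∀ {n} {a b x y z : Fin n} → Joins (a , b) x y → z ≡ a ⊎ z ≡ b → z ≡ x ⊎ z ≡ y
Joins-endpoint (inj₁ (refl , refl)) z∈ab = z∈ab
Joins-endpoint (inj₂ (refl , refl)) z∈ab = Sum.swap z∈ab

touches-at-most-two : ∀ {n} {e : Edge n} {x y z} →
  Touches e x → Touches e y → Touches e z → x ≢ y → z ≡ x ⊎ z ≡ y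
touches-at-most-two tx ty tz x≢y with touches-link⁻ tx
... | _ , l = Joins-endpoint (touching-both-joins l tx ty x≢y) (touches-link l tz)

move-along : ∀ {n} {e : Edge n} {a b u v} → Link e (a , b) → Joins (a , b) u v → u ≢ v → move e u ≡ v
move-along l j u≢v = trans (move-link l _) (transpose-joins j u≢v)

walk-untouched : ∀ {n} (es : List (Edge n)) {p} → (∀ {e} → e ∈ es → ¬ Touches e p) → walk es p ≡ p
walk-untouched []       _  = refl
walk-untouched (e ∷ es) ¬t rewrite move-untouched e (¬t (here refl)) = walk-untouched es (¬t ∘ there)

toℕ-sucMod : ∀ {m} (i : Fin (suc m)) → toℕ i < m → toℕ (sucMod i) ≡ suc (toℕ i)
toℕ-sucMod {suc m} zero    _         = refl
toℕ-sucMod {suc m} (suc i) (s≤s i<m) with sucMod {suc m} i | toℕ-sucMod i i<m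
... | suc j | eq = cong suc eq

sucMod-last : ∀ {m} (i : Fin (suc m)) → toℕ i ≡ m → sucMod i ≡ zero
sucMod-last {zero}  zero    _    = refl
sucMod-last {suc m} (suc i) i≡m with sucMod {suc m} i | sucMod-last i (cong pred i≡m)
... | zero | _ = refl

sucMod-≢ : ∀ {m} (i : Fin (suc (suc m))) → sucMod i ≢ i
sucMod-≢ {m} i eq with ≤-<-connex (suc m) (toℕ i)
... | inj₁ m<i = 0≢1+n (trans (cong toℕ (trans (sym (sucMod-last i i≡m)) eq)) i≡m)
  where i≡m = ≤-antisym (toℕ≤pred[n] i) m<i
... | inj₂ i<m = 1+n≢n (trans (sym (toℕ-sucMod i i<m)) (cong toℕ eq))

sucMod^ : ∀ {m} → ℕ → Fin (suc m)
sucMod^ = fold zero sucMod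

toℕ-sucMod^ : ∀ {m} i → i ≤ m → toℕ (sucMod^ {m} i) ≡ i
toℕ-sucMod^ zero    _   = refl
toℕ-sucMod^ (suc i) i<m = begin
  toℕ (sucMod (sucMod^ i))  ≡⟨ toℕ-sucMod (sucMod^ i) (subst (_< _) (sym ih) i<m) ⟩
  suc (toℕ (sucMod^ i))     ≡⟨ cong suc ih ⟩
  suc i                     ∎
  where
  open ≡-Reasoning
  ih = toℕ-sucMod^ i (<⇒≤ i<m)

sucMod^-toℕ : ∀ {m} (t : Fin (suc m)) → sucMod^ (toℕ t) ≡ t
sucMod^-toℕ t = toℕ-injective (toℕ-sucMod^ (toℕ t) (toℕ≤pred[n] t))

sucMod^-period : ∀ m → sucMod^ {m} (suc m) ≡ zero
sucMod^-period m = sucMod-last (sucMod^ m) (toℕ-sucMod^ m ≤-refl)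

fullCyclic-fixed⇒singleton : ∀ {n s} {π : SignedPerm n} → FullCyclic s π →
  ∀ {x} → proj₂ (π x) ≡ x → ∀ y → y ≡ x
fullCyclic-fixed⇒singleton {suc zero} _ {zero} _ zero = refl
fullCyclic-fixed⇒singleton {suc (suc m)} {π = π} (σ , _ , hop , _) {x} πx≡x y =
  ⊥-elim (sucMod-≢ k (Injection.injective (↔⇒↣ σ) (begin
    σ ⟨$⟩ʳ sucMod k        ≡⟨ cong proj₂ (hop k) ⟨
    proj₂ (π (σ ⟨$⟩ʳ k))   ≡⟨ cong (proj₂ ∘ π) σk≡x ⟩
    proj₂ (π x)            ≡⟨ πx≡x ⟩
    x                      ≡⟨ σk≡x ⟨
    σ ⟨$⟩ʳ k               ∎)))
  where
  open ≡-Reasoning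
  k = σ ⟨$⟩ˡ x
  σk≡x : σ ⟨$⟩ʳ k ≡ x
  σk≡x = inverseʳ σ

cyclic-order-connects : ∀ {m a} {A : Set a} {R : A → A → Set} (f : Fin (suc m) → A) →
  (∀ j → Star R (f j) (f (sucMod j))) → ∀ t → Star R (f zero) (f t)
cyclic-order-connects {R = R} f step t = subst (Star R (f zero) ∘ f) (sucMod^-toℕ t) (reach (toℕ t))
  where
  reach : ∀ i → Star R (f zero) (f (sucMod^ i))
  reach zero    = ε
  reach (suc i) = reach i ◅◅ step (sucMod^ i)

module _ {a} {A : Set a} where

  split : (xs ys : List A) → Fin (length (xs ++ ys)) → Fin (length xs) ⊎ Fin (length ys)
  split []       ys i       = inj₂ i
  split (x ∷ xs) ys zero    = inj₁ zero
  split (x ∷ xs) ys (suc i) = Sum.map suc id (split xs ys i)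

  unsplit : (xs ys : List A) → Fin (length xs) ⊎ Fin (length ys) → Fin (length (xs ++ ys))
  unsplit []       ys (inj₂ j)       = j
  unsplit (x ∷ xs) ys (inj₁ zero)    = zero
  unsplit (x ∷ xs) ys (inj₁ (suc i)) = suc (unsplit xs ys (inj₁ i))
  unsplit (x ∷ xs) ys (inj₂ j)       = suc (unsplit xs ys (inj₂ j))

  unsplit-split : ∀ xs ys i → unsplit xs ys (split xs ys i) ≡ i
  unsplit-split []       ys i       = refl
  unsplit-split (x ∷ xs) ys zero    = refl
  unsplit-split (x ∷ xs) ys (suc i) with split xs ys i | unsplit-split xs ys i
  ... | inj₁ _ | eq = cong suc eq
  ... | inj₂ _ | eq = cong suc eq

  split-injective : ∀ xs ys {i j} → split xs ys i ≡ split xs ys j → i ≡ j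
  split-injective xs ys {i} {j} eq =
    trans (sym (unsplit-split xs ys i)) (trans (cong (unsplit xs ys) eq) (unsplit-split xs ys j))

  lookup-++ : ∀ xs ys i → lookup (xs ++ ys) i ≡ [ lookup xs , lookup ys ] (split xs ys i)
  lookup-++ []       ys i       = refl
  lookup-++ (x ∷ xs) ys zero    = refl
  lookup-++ (x ∷ xs) ys (suc i) with split xs ys i | lookup-++ xs ys i
  ... | inj₁ _ | eq = eq
  ... | inj₂ _ | eq = eq

  Unique-lookup-injective : ∀ {xs : List A} → Unique xs → ∀ {i j} → lookup xs i ≡ lookup xs j → i ≡ j
  Unique-lookup-injective (x∉ ∷ _) {zero}  {zero}  _  = refl
  Unique-lookup-injective (x∉ ∷ _) {zero}  {suc j} eq = ⊥-elim (All.lookup x∉ (∈-lookup j) eq)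
  Unique-lookup-injective (x∉ ∷ _) {suc i} {zero}  eq = ⊥-elim (All.lookup x∉ (∈-lookup i) (sym eq))
  Unique-lookup-injective (_ ∷ u)  {suc i} {suc j} eq = cong suc (Unique-lookup-injective u eq)

  filter-singleton : ∀ {p} {P : Pred A p} (P? : Decidable P) {xs c} → Unique xs → c ∈ xs →
    (∀ {x} → P x → x ≡ c) → P c → filter P? xs ≡ c ∷ []
  filter-singleton P? (x∉ ∷ u) (here refl) only Pc =
    trans (filter-accept P? Pc) (cong (_ ∷_) (filter-none P? (All.map (λ c≢x Px → c≢x (sym (only Px))) x∉)))
  filter-singleton P? {x ∷ _} (x∉ ∷ u) (there c∈) only Pc =
    trans (filter-reject P? (λ Px → All.lookup x∉ c∈ (only Px))) (filter-singleton P? u c∈ only Pc)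

foldl-concatMap-upTo : ∀ {a x} {A : Set a} {X : Set x} (step : X → A → X) (B : ℕ → List A) (w : ℕ → X) N →
  (∀ i → i < N → foldl step (w i) (B i) ≡ w (suc i)) → foldl step (w 0) (concatMap B (upTo N)) ≡ w N
foldl-concatMap-upTo step B w zero    _    = refl
foldl-concatMap-upTo step B w (suc N) hops = begin
  foldl step (w 0) (concatMap B (upTo (suc N)))          ≡⟨ cong (foldl step (w 0) ∘ concatMap B) (upTo-∷ʳ N) ⟨
  foldl step (w 0) (concatMap B (upTo N ∷ʳ N))           ≡⟨ cong (foldl step (w 0)) (concatMap-++ B (upTo N) (N ∷ [])) ⟩
  foldl step (w 0) (concatMap B (upTo N) ++ B N ++ [])   ≡⟨ foldl-++ step (w 0) (concatMap B (upTo N)) (B N ++ []) ⟩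
  foldl step (foldl step (w 0) (concatMap B (upTo N))) (B N ++ [])
    ≡⟨ cong₂ (foldl step) (foldl-concatMap-upTo step B w N (λ i i<N → hops i (m≤n⇒m≤1+n i<N))) (++-identityʳ (B N)) ⟩
  foldl step (w N) (B N)                                 ≡⟨ hops N ≤-refl ⟩
  w (suc N)                                              ∎
  where open ≡-Reasoning

module Blocks {a} {A : Set a} (label : A → ℕ) (xs : List A) where

  block : ℕ → List A
  block i = filter (λ x → label x ≟ℕ i) xs

  blocks : ℕ → List A
  blocks N = concatMap block (upTo N)

  ∈-block⁻ : ∀ {x i} → x ∈ block i → x ∈ xs × label x ≡ i
  ∈-block⁻ = ∈-filter⁻ (λ x → label x ≟ℕ _)

  blocks-↭ : ∀ N → Unique xs → (∀ x → label x < N) → blocks N ↭ xs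
  blocks-↭ N xs! label<N = ∼bag⇒↭ (unique∧set⇒bag blocks! xs! (mk⇔ ∈xs ∈blocks))
    where
    blocks! : Unique (blocks N)
    blocks! = Unique.concat⁺
      (All.map⁺ (All.universal (λ i → Unique.filter⁺ (λ x → label x ≟ℕ i) xs!) (upTo N)))
      (AllPairs.map⁺ (AllPairs.map disjoint (Unique.upTo⁺ N)))
      where
      disjoint : ∀ {i j} → i ≢ j → ∀ {x} → ¬ (x ∈ block i × x ∈ block j)
      disjoint i≢j (x∈i , x∈j) = i≢j (trans (sym (proj₂ (∈-block⁻ x∈i))) (proj₂ (∈-block⁻ x∈j)))
    ∈xs : ∀ {x} → x ∈ blocks N → x ∈ xs
    ∈xs x∈ with ∈-concat⁻′ (map block (upTo N)) x∈
    ... | _ , x∈b , b∈ with ∈-map⁻ block b∈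
    ...   | _ , _ , refl = proj₁ (∈-block⁻ x∈b)
    ∈blocks : ∀ {x} → x ∈ xs → x ∈ blocks N
    ∈blocks {x} x∈ = ∈-concat⁺′ (∈-filter⁺ (λ y → label y ≟ℕ label x) x∈ refl) (∈-map⁺ block (∈-upTo⁺ (label<N x)))

_≟ₑ_ : ∀ {n} → DecidableEquality (Edge n)
posE a b  ≟ₑ posE c d  = map′ (λ { (refl , refl) → refl }) (λ { refl → refl , refl }) (a ≟ c ×-dec b ≟ d)
negE a b  ≟ₑ negE c d  = map′ (λ { (refl , refl) → refl }) (λ { refl → refl , refl }) (a ≟ c ×-dec b ≟ d)
loopE i   ≟ₑ loopE j   = map′ (cong loopE) (λ { refl → refl }) (i ≟ j)
posE _ _  ≟ₑ negE _ _  = no λ ()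
posE _ _  ≟ₑ loopE _   = no λ ()
negE _ _  ≟ₑ posE _ _  = no λ ()
negE _ _  ≟ₑ loopE _   = no λ ()
loopE _   ≟ₑ posE _ _  = no λ ()
loopE _   ≟ₑ negE _ _  = no λ ()

posEdge negEdge : ∀ {n} → Fin n × Fin n → Edge n
posEdge p = posE (proj₁ p) (proj₂ p)
negEdge p = negE (proj₁ p) (proj₂ p)

posEdge-injective : ∀ {n} {p q : Fin n × Fin n} → posEdge p ≡ posEdge q → p ≡ q
posEdge-injective refl = refl

negEdge-injective : ∀ {n} {p q : Fin n × Fin n} → negEdge p ≡ negEdge q → p ≡ q
negEdge-injective refl = refl

Ordered : ∀ {n} → Fin n × Fin n → Set
Ordered p = toℕ (proj₁ p) < toℕ (proj₂ p)

Ordered-joins-unique : ∀ {n} {p q : Fin n × Fin n} {u v} → Ordered p → Ordered q →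
  Joins p u v → Joins q u v → p ≡ q
Ordered-joins-unique _ _ (inj₁ (refl , refl)) (inj₁ (refl , refl)) = refl
Ordered-joins-unique _ _ (inj₂ (refl , refl)) (inj₂ (refl , refl)) = refl
Ordered-joins-unique p< q< (inj₁ (refl , refl)) (inj₂ (refl , refl)) = ⊥-elim (<-asym p< q<)
Ordered-joins-unique p< q< (inj₂ (refl , refl)) (inj₁ (refl , refl)) = ⊥-elim (<-asym p< q<)

Ordered-joins-distinct : ∀ {n} {p : Fin n × Fin n} {u v} → Ordered p → Joins p u v → u ≢ v
Ordered-joins-distinct p< (inj₁ (refl , refl)) refl = <-irrefl refl p<
Ordered-joins-distinct p< (inj₂ (refl , refl)) refl = <-irrefl refl p<

Joins-sym : ∀ {n} {p : Fin n × Fin n} {u v} → Joins p u v → Joins p v u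
Joins-sym = Sum.swap

three-links : ∀ {n} {e₁ e₂ e₃ : Edge n} {p} → Link e₁ p → Link e₂ p → Link e₃ p →
  e₁ ≡ e₂ ⊎ e₁ ≡ e₃ ⊎ e₂ ≡ e₃
three-links pos pos _   = inj₁ refl
three-links neg neg _   = inj₁ refl
three-links pos neg pos = inj₂ (inj₁ refl)
three-links pos neg neg = inj₂ (inj₂ refl)
three-links neg pos pos = inj₂ (inj₂ refl)
three-links neg pos neg = inj₂ (inj₁ refl)

module _ {n} (G : SignedGraph n) where

  barG-ordered : All.All Ordered (barG G)
  barG-ordered = All.++⁺ (E⁺-ordered G) (E⁻-ordered G)

  link-∈ : ∀ {e p} → e ∈ edges G → Link e p → p ∈ barG G
  link-∈ e∈ pos with ∈-++⁻ (map posEdge (E⁺ G)) e∈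
  ... | inj₁ e∈⁺ with ∈-map⁻ posEdge e∈⁺
  ...   | _ , p∈ , refl = ∈-++⁺ˡ p∈
  link-∈ e∈ pos | inj₂ e∈′ with ∈-++⁻ (map negEdge (E⁻ G)) e∈′
  ...   | inj₁ e∈⁻ with ∈-map⁻ negEdge e∈⁻
  ...     | _ , _ , ()
  link-∈ e∈ pos | inj₂ e∈′ | inj₂ e∈ᴸ with ∈-map⁻ loopE e∈ᴸ
  ...     | _ , _ , ()
  link-∈ e∈ neg with ∈-++⁻ (map posEdge (E⁺ G)) e∈
  ... | inj₁ e∈⁺ with ∈-map⁻ posEdge e∈⁺
  ...   | _ , _ , ()
  link-∈ e∈ neg | inj₂ e∈′ with ∈-++⁻ (map negEdge (E⁻ G)) e∈′
  ...   | inj₁ e∈⁻ with ∈-map⁻ negEdge e∈⁻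
  ...     | _ , p∈ , refl = ∈-++⁺ʳ (E⁺ G) p∈
  link-∈ e∈ neg | inj₂ e∈′ | inj₂ e∈ᴸ with ∈-map⁻ loopE e∈ᴸ
  ...     | _ , _ , ()

  link-ordered : ∀ {e p} → e ∈ edges G → Link e p → Ordered p
  link-ordered e∈ l = All.lookup barG-ordered (link-∈ e∈ l)

  edges-unique : Unique (edges G)
  edges-unique =
    Unique.++⁺ (Unique.map⁺ posEdge-injective (E⁺-unique G))
      (Unique.++⁺ (Unique.map⁺ negEdge-injective (E⁻-unique G)) (Unique.map⁺ loopE-injective (L-unique G))
        neg-disjoint)
      pos-disjoint
    where
    loopE-injective : ∀ {i j : Fin n} → loopE i ≡ loopE j → i ≡ j
    loopE-injective refl = refl
    neg-disjoint : ∀ {e} → ¬ (e ∈ map negEdge (E⁻ G) × e ∈ map loopE (L G))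
    neg-disjoint (∈⁻ , ∈ᴸ) with ∈-map⁻ negEdge ∈⁻ | ∈-map⁻ loopE ∈ᴸ
    ... | _ , _ , refl | _ , _ , ()
    pos-disjoint : ∀ {e} → ¬ (e ∈ map posEdge (E⁺ G) × e ∈ map negEdge (E⁻ G) ++ map loopE (L G))
    pos-disjoint (∈⁺ , ∈′) with ∈-map⁻ posEdge ∈⁺ | ∈-++⁻ (map negEdge (E⁻ G)) ∈′
    ... | _ , _ , refl | inj₁ ∈⁻ with ∈-map⁻ negEdge ∈⁻
    ...   | _ , _ , ()
    pos-disjoint (∈⁺ , ∈′) | _ , _ , refl | inj₂ ∈ᴸ with ∈-map⁻ loopE ∈ᴸ
    ...   | _ , _ , ()

  barEdge : Fin (length (barG G)) → Edge n
  barEdge j = [ posEdge ∘ lookup (E⁺ G) , negEdge ∘ lookup (E⁻ G) ] (split (E⁺ G) (E⁻ G) j)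

  barEdge-link : ∀ j → Link (barEdge j) (lookup (barG G) j)
  barEdge-link j with split (E⁺ G) (E⁻ G) j | lookup-++ (E⁺ G) (E⁻ G) j
  ... | inj₁ _ | eq rewrite eq = pos
  ... | inj₂ _ | eq rewrite eq = neg

  barEdge-∈ : ∀ j → barEdge j ∈ edges G
  barEdge-∈ j with split (E⁺ G) (E⁻ G) j
  ... | inj₁ i = ∈-++⁺ˡ (∈-map⁺ posEdge (∈-lookup {xs = E⁺ G} i))
  ... | inj₂ i = ∈-++⁺ʳ (map posEdge (E⁺ G)) (∈-++⁺ˡ (∈-map⁺ negEdge (∈-lookup {xs = E⁻ G} i)))

  barEdge-injective : ∀ {i j} → barEdge i ≡ barEdge j → i ≡ j
  barEdge-injective {i} {j} eq =
    split-injective (E⁺ G) (E⁻ G) (side-injective (split (E⁺ G) (E⁻ G) i) (split (E⁺ G) (E⁻ G) j) eq)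
    where
    side-injective : ∀ s t → [ posEdge ∘ lookup (E⁺ G) , negEdge ∘ lookup (E⁻ G) ] s
                           ≡ [ posEdge ∘ lookup (E⁺ G) , negEdge ∘ lookup (E⁻ G) ] t → s ≡ t
    side-injective (inj₁ a) (inj₁ b) eq = cong inj₁ (Unique-lookup-injective (E⁺-unique G) (posEdge-injective eq))
    side-injective (inj₁ a) (inj₂ b) ()
    side-injective (inj₂ a) (inj₁ b) ()
    side-injective (inj₂ a) (inj₂ b) eq = cong inj₂ (Unique-lookup-injective (E⁻-unique G) (negEdge-injective eq))

  Adjacent-sym : ∀ {u v} → Adjacent (barG G) u v → Adjacent (barG G) v u
  Adjacent-sym (p , p∈ , j) = p , p∈ , Joins-sym j

  link-reaches : ∀ {e a b} → Link e (a , b) → e ∈ edges G → ∀ p → Star (Adjacent (barG G)) p (move e p)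
  link-reaches {a = a} {b} l e∈ p rewrite move-link l p with transpose-stays-or-crosses a b p
  ... | inj₁ stays   = subst (Star _ p) (sym stays) ε
  ... | inj₂ crosses = ((a , b) , link-∈ e∈ l , crosses) ◅ ε

  move-reaches : ∀ {e} → e ∈ edges G → ∀ p → Star (Adjacent (barG G)) p (move e p)
  move-reaches {posE _ _} = link-reaches pos
  move-reaches {negE _ _} = link-reaches neg
  move-reaches {loopE i} _ p = subst (Star _ p) (sym (move-loop i p)) ε

  walk-reaches : ∀ es → (∀ {e} → e ∈ es → e ∈ edges G) → ∀ p → Star (Adjacent (barG G)) p (walk es p)
  walk-reaches []       _  p = ε
  walk-reaches (e ∷ es) ⊆G p = move-reaches (⊆G (here refl)) p ◅◅ walk-reaches es (⊆G ∘ there) (move e p)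

  Between : Fin n → Fin n → Edge n → Set
  Between u v e = e ∈ edges G × Σ (Fin n × Fin n) λ p → Link e p × Joins p u v

  Between-sym : ∀ {u v e} → Between u v e → Between v u e
  Between-sym (e∈ , p , l , j) = e∈ , p , l , Joins-sym j

  at-most-two-between : ∀ {u v e₁ e₂ e₃} → Between u v e₁ → Between u v e₂ → Between u v e₃ →
    e₁ ≢ e₂ → e₁ ≢ e₃ → e₂ ≢ e₃ → ⊥
  at-most-two-between (e₁∈ , p₁ , l₁ , j₁) (e₂∈ , p₂ , l₂ , j₂) (e₃∈ , p₃ , l₃ , j₃) e₁≢e₂ e₁≢e₃ e₂≢e₃
    with three-links l₁ (subst (Link _) (same e₂∈ l₂ j₂) l₂) (subst (Link _) (same e₃∈ l₃ j₃) l₃)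
    where
    same : ∀ {e p} → e ∈ edges G → Link e p → Joins p _ _ → p ≡ p₁
    same e∈ l j = Ordered-joins-unique (link-ordered e∈ l) (link-ordered e₁∈ l₁) j j₁
  ... | inj₁ e₁≡e₂        = e₁≢e₂ e₁≡e₂
  ... | inj₂ (inj₁ e₁≡e₃) = e₁≢e₃ e₁≡e₃
  ... | inj₂ (inj₂ e₂≡e₃) = e₂≢e₃ e₂≡e₃

  touching-both-between : ∀ {e u v} → e ∈ edges G → Touches e u → Touches e v → u ≢ v → Between u v e
  touching-both-between e∈ tu tv u≢v with touches-link⁻ tu
  ... | (a , b) , l = e∈ , (a , b) , l , touching-both-joins l tu tv u≢v

connected : ∀ {n} (G : SignedGraph n) {s} → (∀ ω → EdgeOrdering G ω → FullCyclic s (πω ω)) → Connected (barG G)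
connected {suc m} G H with H (edges G) ↭-refl
... | σ , _ , hop , _ = λ u v → reverse (Adjacent-sym G) (from-σ₀ u) ◅◅ from-σ₀ v
  where
  step : ∀ j → Star (Adjacent (barG G)) (σ ⟨$⟩ʳ j) (σ ⟨$⟩ʳ sucMod j)
  step j = subst (Star _ _) (trans (sym (proj₂-πω (edges G) _)) (cong proj₂ (hop j)))
                 (walk-reaches G (edges G) id (σ ⟨$⟩ʳ j))
  from-σ₀ : ∀ u → Star (Adjacent (barG G)) (σ ⟨$⟩ʳ zero) u
  from-σ₀ u = subst (Star _ _) (inverseʳ σ) (cyclic-order-connects (σ ⟨$⟩ʳ_) step (σ ⟨$⟩ˡ u))

module CycleOrdering {n} (G : SignedGraph n) {k} (vs : Fin (suc (suc k)) → Fin n)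
  (ix : Fin (suc (suc k)) → Fin (length (barG G)))
  (vs-injective : Injective _≡_ _≡_ vs) (ix-injective : Injective _≡_ _≡_ ix)
  (joins : ∀ t → Joins (lookup (barG G) (ix t)) (vs t) (vs (sucMod t))) where

  cycleEdge : Fin (suc (suc k)) → Edge n
  cycleEdge = barEdge G ∘ ix

  cycleEdge-injective : Injective _≡_ _≡_ cycleEdge
  cycleEdge-injective = ix-injective ∘ barEdge-injective G

  cycleEdge-between : ∀ t → Between G (vs t) (vs (sucMod t)) (cycleEdge t)
  cycleEdge-between t = barEdge-∈ G (ix t) , _ , barEdge-link G (ix t) , joins t

  cycleEdge-moves : ∀ t → move (cycleEdge t) (vs t) ≡ vs (sucMod t)
  cycleEdge-moves t = move-along (barEdge-link G (ix t)) (joins t) (sucMod-≢ t ∘ sym ∘ vs-injective)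

  v : ℕ → Fin n
  v i = vs (sucMod^ i)

  v₀≢v₁ : v 0 ≢ v 1
  v₀≢v₁ eq with vs-injective eq
  ... | ()

  v₂≢v₁ : v 2 ≢ v 1
  v₂≢v₁ = sucMod-≢ (suc zero) ∘ vs-injective

  OffCycle : Edge n → Set
  OffCycle e = ∀ t → cycleEdge t ≢ e

  -- If v 2 = v 0 the cycle has length two, and e would be a third edge between v 0 and v 1.
  parallel-avoids-v₂ : ∀ {e} → e ∈ edges G → OffCycle e →
    Touches e (v 0) → Touches e (v 1) → ¬ Touches e (v 2)
  parallel-avoids-v₂ {e} e∈ off t₀ t₁ t₂ with v 2 ≟ v 0
  ... | no v₂≢v₀ = [ v₂≢v₀ , v₂≢v₁ ] (touches-at-most-two t₀ t₁ t₂ v₀≢v₁)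
  ... | yes v₂≡v₀ =
    at-most-two-between G (touching-both-between G e∈ t₀ t₁ v₀≢v₁) (cycleEdge-between zero) closing
      (off zero ∘ sym) (off (suc zero) ∘ sym) ((λ ()) ∘ cycleEdge-injective)
    where
    closing : Between G (v 0) (v 1) (cycleEdge (suc zero))
    closing = subst (λ x → Between G x (v 1) _) v₂≡v₀ (Between-sym G (cycleEdge-between (suc zero)))

  InBlock : Edge n → ℕ → Set
  InBlock e 0 = ¬ Touches e (v 0)
  InBlock e 1 = cycleEdge zero ≡ e
  InBlock e 2 = Touches e (v 0) × ¬ Touches e (v 1)
  InBlock e 3 = cycleEdge (suc zero) ≡ e
  InBlock e 4 = OffCycle e × Touches e (v 0) × Touches e (v 1)
  InBlock e (suc (suc (suc (suc (suc i))))) = Σ (Fin k) λ j → toℕ j ≡ i × cycleEdge (suc (suc j)) ≡ e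

  cycleLabel : Fin (suc (suc k)) → ℕ
  cycleLabel zero          = 1
  cycleLabel (suc zero)    = 3
  cycleLabel (suc (suc j)) = 5 + toℕ j

  InBlock-cycleLabel⁺ : ∀ t {e} → cycleEdge t ≡ e → InBlock e (cycleLabel t)
  InBlock-cycleLabel⁺ zero          c = c
  InBlock-cycleLabel⁺ (suc zero)    c = c
  InBlock-cycleLabel⁺ (suc (suc j)) c = j , refl , c

  InBlock-cycleLabel⁻ : ∀ t {e} → InBlock e (cycleLabel t) → e ≡ cycleEdge t
  InBlock-cycleLabel⁻ zero          c            = sym c
  InBlock-cycleLabel⁻ (suc zero)    c            = sym c
  InBlock-cycleLabel⁻ (suc (suc j)) (_ , j≡ , c) = trans (sym c) (cong (λ j → cycleEdge (suc (suc j))) (toℕ-injective j≡))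

  InBlock-bound : ∀ {e} i → InBlock e i → i < 5 + k
  InBlock-bound 0 _ = s≤s z≤n
  InBlock-bound 1 _ = s≤s (s≤s z≤n)
  InBlock-bound 2 _ = s≤s (s≤s (s≤s z≤n))
  InBlock-bound 3 _ = s≤s (s≤s (s≤s (s≤s z≤n)))
  InBlock-bound 4 _ = s≤s (s≤s (s≤s (s≤s (s≤s z≤n))))
  InBlock-bound (suc (suc (suc (suc (suc _))))) (j , refl , _) = +-monoʳ-< 5 (toℕ<n j)

  classify : ∀ e → Σ ℕ (InBlock e)
  classify e with any? (λ t → cycleEdge t ≟ₑ e)
  ... | yes (t , c) = cycleLabel t , InBlock-cycleLabel⁺ t c
  ... | no off with touches? e (v 0) | touches? e (v 1)
  ...   | no ¬t₀ | _      = 0 , ¬t₀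
  ...   | yes t₀ | no ¬t₁ = 2 , t₀ , ¬t₁
  ...   | yes t₀ | yes t₁ = 4 , (λ t c → off (t , c)) , t₀ , t₁

  label : Edge n → ℕ
  label = proj₁ ∘ classify

  label-cycleEdge : ∀ t → label (cycleEdge t) ≡ cycleLabel t
  label-cycleEdge t with any? (λ t′ → cycleEdge t′ ≟ₑ cycleEdge t)
  ... | yes (t′ , c) = cong cycleLabel (cycleEdge-injective c)
  ... | no off       = ⊥-elim (off (t , refl))

  open Blocks label (edges G)

  ∈-block⇒InBlock : ∀ {e i} → e ∈ block i → e ∈ edges G × InBlock e i
  ∈-block⇒InBlock {e} e∈ with ∈-block⁻ e∈
  ... | e∈G , refl = e∈G , proj₂ (classify e)

  stay-block : ∀ i {p} → (∀ {e} → e ∈ edges G → InBlock e i → ¬ Touches e p) → walk (block i) p ≡ p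
  stay-block i avoids = walk-untouched (block i) λ e∈ → let e∈G , inB = ∈-block⇒InBlock e∈ in avoids e∈G inB

  cycle-block : ∀ t → walk (block (cycleLabel t)) (vs t) ≡ vs (sucMod t)
  cycle-block t rewrite filter-singleton (λ e → label e ≟ℕ cycleLabel t) (edges-unique G) (barEdge-∈ G (ix t))
                          (λ {e} eq → InBlock-cycleLabel⁻ t (subst (InBlock e) eq (proj₂ (classify e)))) (label-cycleEdge t)
    = cycleEdge-moves t

  -- Where the blocks before block i carry v 0.
  token : ℕ → Fin n
  token 0 = v 0
  token 1 = v 0
  token 2 = v 1
  token 3 = v 1
  token 4 = v 2
  token (suc (suc (suc (suc (suc i))))) = v (2 + i)

  walk-block : ∀ i → i < 5 + k → walk (block i) (token i) ≡ token (suc i)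
  walk-block 0 _ = stay-block 0 λ _ ¬t₀ → ¬t₀
  walk-block 1 _ = cycle-block zero
  walk-block 2 _ = stay-block 2 λ _ → proj₂
  walk-block 3 _ = cycle-block (suc zero)
  walk-block 4 _ = stay-block 4 λ e∈ (off , t₀ , t₁) → parallel-avoids-v₂ e∈ off t₀ t₁
  walk-block (suc (suc (suc (suc (suc i))))) (s≤s (s≤s (s≤s (s≤s (s≤s i<k))))) =
    subst (λ i → walk (block (5 + i)) (v (2 + i)) ≡ v (3 + i)) (toℕ-fromℕ< i<k) (cycle-block′ (fromℕ< i<k))
    where
    cycle-block′ : ∀ j → walk (block (5 + toℕ j)) (v (2 + toℕ j)) ≡ v (3 + toℕ j)
    cycle-block′ j rewrite sucMod^-toℕ {suc k} (suc (suc j)) = cycle-block (suc (suc j))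

  ordering : List (Edge n)
  ordering = blocks (5 + k)

  ordering-↭ : EdgeOrdering G ordering
  ordering-↭ = blocks-↭ (5 + k) (edges-unique G) (λ e → InBlock-bound _ (proj₂ (classify e)))

  ordering-fixes-v₀ : proj₂ (πω ordering (v 0)) ≡ v 0
  ordering-fixes-v₀ = begin
    proj₂ (πω ordering (v 0))  ≡⟨ proj₂-πω ordering (v 0) ⟩
    walk ordering (token 0)    ≡⟨ foldl-concatMap-upTo (λ p e → move e p) block token (5 + k) walk-block ⟩
    vs (sucMod^ (2 + k))       ≡⟨ cong vs (sucMod^-period (suc k)) ⟩
    v 0                        ∎
    where open ≡-Reasoning

  ordering-not-full-cyclic : ∀ {s} → ¬ FullCyclic s (πω ordering)
  ordering-not-full-cyclic fc = v₀≢v₁ (sym (fullCyclic-fixed⇒singleton {π = πω ordering} fc ordering-fixes-v₀ (v 1)))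

acyclic : ∀ {n} (G : SignedGraph n) {s} → (∀ ω → EdgeOrdering G ω → FullCyclic s (πω ω)) → Acyclic (barG G)
acyclic G H record { k = zero ; ix = ix ; joins = joins } =
  Ordered-joins-distinct (All.lookup (barG-ordered G) (∈-lookup (ix zero))) (joins zero) refl
acyclic G H record { k = suc k ; vs = vs ; ix = ix ; vs-inj = vs-inj ; ix-inj = ix-inj ; joins = joins } =
  ordering-not-full-cyclic (H ordering ordering-↭)
  where open CycleOrdering G vs ix vs-inj ix-inj joins

proposition3p2 : (n : ℕ) (G : SignedGraph n) (s : Sign) →
    (∀ (ω : List (Edge n)) → EdgeOrdering G ω → FullCyclic s (πω ω)) →
    IsTree (barG G)
proposition3p2 n G s H = connected G H , acyclic G H
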